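{- Let $p>3$ be a prime with $p\equiv -1 \pmod 6$, let $q$ be an odd power of $p$, and let $r$ be a sufficiently large power of $p$ (in the sense of the context). Let $E$ be the elliptic curve $y^2=x^3+t^q-t$ over $\mathbb{F}_r(t)$. Then every non-identity point $P\in E(\mathbb{F}_r(t))$ satisfies $h(P)\geq \frac{q+1}{3}$, where $h$ is the naive height.
   Context: Write $q=p^c$ with $c$ odd. A power $r=p^s$ is called sufficiently large if $c$ divides $s$, $8$ divides $(p+1)s$, and $3(p^c-1)$ divides $p^s-1$. The naive height of a point $P=(x,y)\in E(\mathbb{F}_r(t))$ is $h(P)=\deg(x):=\max(\deg f,\deg g)$, where $x=f(t)/g(t)$ with $f,g\in\mathbb{F}_r[t]$ coprime; for the identity $P=[0:1:0]$ one sets $h(P)=0$. -}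

module Defs where

open import Level using (0ℓ)
open import Algebra.Bundles using (CommutativeRing)
open import Data.Nat as ℕ using (ℕ; zero; suc; _∸_; _^_; _%_)
open import Data.Nat.Divisibility using (_∣_)
open import Data.Fin using (Fin)
open import Data.List using (List; []; _∷_; map)
open import Data.Maybe using (Maybe; just; nothing; fromMaybe)
open import Data.Bool using (true; false)
open import Data.Product using (∃; Σ; _×_)
open import Data.Empty using (⊥)
open import Relation.Nullary using (¬_; does)
open import Relation.Binary using (Decidable)
open import Relation.Binary.PropositionalEquality as ≡ using (_≡_)
open import Function.Bundles using (Inverse)

-- r = p^s is "sufficiently large" relative to q = p^c
SufficientlyLarge : ℕ → ℕ → ℕ → Set
SufficientlyLarge p c s =
  (c ∣ s) × ((8 ∣ (p ℕ.+ 1) ℕ.* s) × ((3 ℕ.* (p ^ c ∸ 1)) ∣ (p ^ s ∸ 1)))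

IsField : CommutativeRing 0ℓ 0ℓ → Set
IsField R = (¬ (1# ≈ 0#)) × (∀ x → ¬ (x ≈ 0#) → ∃ λ y → (x * y) ≈ 1#)
  where open CommutativeRing R

HasCardinality : CommutativeRing 0ℓ 0ℓ → ℕ → Set
HasCardinality R n = Inverse (CommutativeRing.setoid R) (≡.setoid (Fin n))

-- polynomials over R as coefficient lists (constant term first),
-- compared coefficientwise
module Poly (R : CommutativeRing 0ℓ 0ℓ) where
  open CommutativeRing R

  Pol : Set
  Pol = List Carrier

  coeff : Pol → ℕ → Carrier
  coeff [] _ = 0#
  coeff (a ∷ f) zero = a
  coeff (a ∷ f) (suc i) = coeff f i

  infix 4 _≈ₚ_
  _≈ₚ_ : Pol → Pol → Set
  f ≈ₚ g = ∀ i → coeff f i ≈ coeff g i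

  infixl 6 _+ₚ_ _-ₚ_
  infixl 7 _*ₚ_
  infixr 8 _^ₚ_

  _+ₚ_ : Pol → Pol → Pol
  [] +ₚ g = g
  (a ∷ f) +ₚ [] = a ∷ f
  (a ∷ f) +ₚ (b ∷ g) = (a + b) ∷ (f +ₚ g)

  negₚ : Pol → Pol
  negₚ = map (λ a → - a)

  _-ₚ_ : Pol → Pol → Pol
  f -ₚ g = f +ₚ negₚ g

  scale : Carrier → Pol → Pol
  scale a = map (a *_)

  _*ₚ_ : Pol → Pol → Pol
  [] *ₚ g = []
  (a ∷ f) *ₚ g = scale a g +ₚ (0# ∷ (f *ₚ g))

  oneₚ : Pol
  oneₚ = 1# ∷ []

  T : Pol
  T = 0# ∷ 1# ∷ []

  _^ₚ_ : Pol → ℕ → Pol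
  f ^ₚ zero = oneₚ
  f ^ₚ suc n = f *ₚ (f ^ₚ n)

  NonzeroPol : Pol → Set
  NonzeroPol f = ¬ (f ≈ₚ [])

  _∣ₚ_ : Pol → Pol → Set
  d ∣ₚ f = ∃ λ e → d *ₚ e ≈ₚ f

  module Degree (_≟_ : Decidable _≈_) where
    top : Pol → Maybe ℕ
    top [] = nothing
    top (a ∷ f) with top f
    ... | just n = just (suc n)
    ... | nothing with does (a ≟ 0#)
    ...   | true = nothing
    ...   | false = just 0

    -- degree (the zero polynomial gets degree 0)
    deg : Pol → ℕ
    deg f = fromMaybe 0 (top f)

    Coprime : Pol → Pol → Set
    Coprime f g = ∀ d → d ∣ₚ f → d ∣ₚ g → deg d ≡ 0

    -- naive height of the point with x = f/g
    height : Pol → Pol → ℕ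
    height f g = ℕ._⊔_ (deg f) (deg g)

  -- (f/g, u/v) lies on y^2 = x^3 + t^q - t, denominators cleared
  OnCurve : ℕ → Pol → Pol → Pol → Pol → Set
  OnCurve q f g u v =
    (u ^ₚ 2) *ₚ (g ^ₚ 3)
      ≈ₚ (v ^ₚ 2) *ₚ ((f ^ₚ 3) +ₚ ((T ^ₚ q) -ₚ T) *ₚ (g ^ₚ 3))

{-# OPTIONS --safe #-}
-- If 3 h(P) ≤ q with x = f/g, then 3 deg f < q + 3 deg g (equality is excluded
-- because 3 ∤ q), so the leading term of f³ + (t^q - t) g³ is that of t^q g³ and
-- x³ + t^q - t has odd degree q as a rational function.  It therefore cannot be
-- the square y², whose degree is even: clearing denominators,
-- 2 deg u + 3 deg g = 2 deg v + q + 3 deg g would make q even.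
module Submission where

open import Defs
open import Level using (0ℓ)
open import Algebra.Bundles using (CommutativeRing)
open import Data.Nat using (ℕ; _^_; _%_; _<_; _≤_; _*_; _+_)
open import Data.Nat.Primality using (Prime)
open import Relation.Binary using (Decidable)
open import Relation.Binary.PropositionalEquality using (_≡_)

open import Data.Nat using (zero; suc; s≤s; z≤n; _≤?_)
open import Data.Nat.Properties
  using (≤-trans; <-trans; <-cmp; m≤n+m; m≤m+n; m≤m⊔n; <⇒≤; m<1+n⇒m≤n; ≰⇒>; ≤∧≢⇒<;
         *-monoʳ-≤; +-comm; +-assoc; +-cancelʳ-≡; ^-monoʳ-<)
open import Data.Nat.Divisibility using (_∣_; _∤_; ∣m+n∣m⇒∣n; ∣1⇒≡1; m∣m*n)
open import Data.Nat.Divisibility.Core using (hasNonTrivialDivisor)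
open import Data.Nat.Primality using (euclidsLemma; prime⇒¬composite; prime⇒nonTrivial; ¬prime[1]; prime[2]; prime?)
open import Data.List using ([]; _∷_)
open import Data.Maybe using (Maybe; just; nothing)
open import Data.Product using (_,_; proj₁)
open import Data.Sum using (_⊎_; inj₁; inj₂)
open import Data.Empty using (⊥-elim)
open import Relation.Binary using (tri<; tri≈; tri>)
open import Relation.Nullary using (¬_; yes; no)
open import Relation.Nullary.Decidable using (from-yes)
open import Function using (_∘_)
open import Relation.Binary.PropositionalEquality as ≡ using ()

prime[3] : Prime 3
prime[3] = from-yes (prime? 3)

prime∣^⇒∣ : ∀ {d} m k → Prime d → d ∣ m ^ k → d ∣ m
prime∣^⇒∣ m zero d-prime d∣1 = ⊥-elim (¬prime[1] (≡.subst Prime (∣1⇒≡1 d∣1) d-prime))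
prime∣^⇒∣ m (suc k) d-prime d∣m^k+1 with euclidsLemma m (m ^ k) d-prime d∣m^k+1
... | inj₁ d∣m = d∣m
... | inj₂ d∣m^k = prime∣^⇒∣ m k d-prime d∣m^k

prime∤prime^ : ∀ {d p} k → Prime d → Prime p → d < p → d ∤ p ^ k
prime∤prime^ k d-prime p-prime d<p d∣p^k =
  prime⇒¬composite p-prime (hasNonTrivialDivisor {{prime⇒nonTrivial d-prime}} d<p (prime∣^⇒∣ _ k d-prime d∣p^k))

∤⇒*≤+*⇒*<+* : ∀ {d q a b} → d ∤ q → d * a ≤ q + d * b → d * a < q + d * b
∤⇒*≤+*⇒*<+* {d} {q} {a} {b} d∤q da≤q+db = ≤∧≢⇒< da≤q+db λ da≡q+db →
  d∤q (∣m+n∣m⇒∣n (≡.subst (d ∣_) (≡.trans da≡q+db (+-comm q (d * b))) (m∣m*n a)) (m∣m*n b))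

*+≡*+[+]⇒∣ : ∀ {d a b q k} → d * a + k ≡ d * b + (q + k) → d ∣ q
*+≡*+[+]⇒∣ {d} {a} {b} {q} {k} eq =
  ∣m+n∣m⇒∣n (≡.subst (d ∣_) da≡db+q (m∣m*n a)) (m∣m*n b)
  where
  da≡db+q : d * a ≡ d * b + q
  da≡db+q = +-cancelʳ-≡ k (d * a) (d * b + q) (≡.trans eq (≡.sym (+-assoc (d * b) q k)))

IsField⇒*-nonzero : (R : CommutativeRing 0ℓ 0ℓ) → IsField R →
  let open CommutativeRing R renaming (_*_ to _⊗_) in ∀ {x y} → ¬ x ≈ 0# → ¬ y ≈ 0# → ¬ x ⊗ y ≈ 0#
IsField⇒*-nonzero R (1≉0 , inverse) {x} {y} x≉0 y≉0 xy≈0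
  with inverse x x≉0 | inverse y y≉0
... | x⁻¹ , xx⁻¹≈1 | y⁻¹ , yy⁻¹≈1 = 1≉0 (begin
  1#                      ≈⟨ sym (*-identityˡ 1#) ⟩
  1# ⊗ 1#                 ≈⟨ *-cong (sym xx⁻¹≈1) (sym yy⁻¹≈1) ⟩
  (x ⊗ x⁻¹) ⊗ (y ⊗ y⁻¹)   ≈⟨ *-assoc x x⁻¹ (y ⊗ y⁻¹) ⟩
  x ⊗ (x⁻¹ ⊗ (y ⊗ y⁻¹))   ≈⟨ *-congˡ (*-comm x⁻¹ (y ⊗ y⁻¹)) ⟩
  x ⊗ ((y ⊗ y⁻¹) ⊗ x⁻¹)   ≈⟨ *-congˡ (*-assoc y y⁻¹ x⁻¹) ⟩
  x ⊗ (y ⊗ (y⁻¹ ⊗ x⁻¹))   ≈⟨ sym (*-assoc x y (y⁻¹ ⊗ x⁻¹)) ⟩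
  (x ⊗ y) ⊗ (y⁻¹ ⊗ x⁻¹)   ≈⟨ *-congʳ xy≈0 ⟩
  0# ⊗ (y⁻¹ ⊗ x⁻¹)        ≈⟨ zeroˡ _ ⟩
  0#                      ∎)
  where
  open CommutativeRing R renaming (_*_ to _⊗_)
  open import Relation.Binary.Reasoning.Setoid setoid

module PolynomialDegree (R : CommutativeRing 0ℓ 0ℓ) where
  open CommutativeRing R renaming (_+_ to _⊕_; _*_ to _⊗_)
  open import Algebra.Properties.Ring ring using (-0#≈0#)
  open Poly R
  open import Relation.Binary.Reasoning.Setoid setoid

  IsZero : Pol → Set
  IsZero f = ∀ i → coeff f i ≈ 0#

  DegreeAtMost : Pol → ℕ → Set
  DegreeAtMost f k = ∀ i → k < i → coeff f i ≈ 0#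

  record HasDegree (f : Pol) (n : ℕ) : Set where
    constructor _,_
    field
      leading≉0 : ¬ coeff f n ≈ 0#
      degreeAtMost : DegreeAtMost f n

  coeff-+ₚ : ∀ f g i → coeff (f +ₚ g) i ≈ coeff f i ⊕ coeff g i
  coeff-+ₚ [] g i = sym (+-identityˡ _)
  coeff-+ₚ (a ∷ f) [] i = sym (+-identityʳ _)
  coeff-+ₚ (a ∷ f) (b ∷ g) zero = refl
  coeff-+ₚ (a ∷ f) (b ∷ g) (suc i) = coeff-+ₚ f g i

  coeff-negₚ : ∀ f i → coeff (negₚ f) i ≈ - coeff f i
  coeff-negₚ [] i = sym -0#≈0#
  coeff-negₚ (a ∷ f) zero = refl
  coeff-negₚ (a ∷ f) (suc i) = coeff-negₚ f i

  coeff-scale : ∀ a f i → coeff (scale a f) i ≈ a ⊗ coeff f i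
  coeff-scale a [] i = sym (zeroʳ a)
  coeff-scale a (b ∷ f) zero = refl
  coeff-scale a (b ∷ f) (suc i) = coeff-scale a f i

  coeff-∷-*ₚ : ∀ a f g i → coeff ((a ∷ f) *ₚ g) i ≈ a ⊗ coeff g i ⊕ coeff (0# ∷ (f *ₚ g)) i
  coeff-∷-*ₚ a f g i = trans (coeff-+ₚ (scale a g) (0# ∷ (f *ₚ g)) i) (+-congʳ (coeff-scale a g i))

  isZero-∷0# : ∀ {f} → IsZero f → IsZero (0# ∷ f)
  isZero-∷0# zero-f zero = refl
  isZero-∷0# zero-f (suc i) = zero-f i

  isZero-*ₚ : ∀ f g → IsZero f → IsZero (f *ₚ g)
  isZero-*ₚ [] g _ i = refl
  isZero-*ₚ (a ∷ f) g zero-af i = begin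
    coeff ((a ∷ f) *ₚ g) i                  ≈⟨ coeff-∷-*ₚ a f g i ⟩
    a ⊗ coeff g i ⊕ coeff (0# ∷ (f *ₚ g)) i ≈⟨ +-cong a⊗g[i]≈0 (isZero-∷0# (isZero-*ₚ f g (zero-af ∘ suc)) i) ⟩
    0# ⊕ 0#                                 ≈⟨ +-identityˡ 0# ⟩
    0#                                      ∎
    where
    a⊗g[i]≈0 : a ⊗ coeff g i ≈ 0#
    a⊗g[i]≈0 = trans (*-congʳ (zero-af 0)) (zeroˡ _)

  isZero⇒degreeAtMost : ∀ f → IsZero f → ∀ k → DegreeAtMost f k
  isZero⇒degreeAtMost f zero-f k i _ = zero-f i

  degreeAtMost-negₚ : ∀ f {k} → DegreeAtMost f k → DegreeAtMost (negₚ f) k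
  degreeAtMost-negₚ f f≤k i k<i = trans (coeff-negₚ f i) (trans (-‿cong (f≤k i k<i)) -0#≈0#)

  hasDegree-resp : ∀ {f g n} → f ≈ₚ g → HasDegree f n → HasDegree g n
  hasDegree-resp f≈g (lead , f≤n) =
    (λ g[n]≈0 → lead (trans (f≈g _) g[n]≈0)) , λ i n<i → trans (sym (f≈g i)) (f≤n i n<i)

  hasDegree-unique : ∀ {f m n} → HasDegree f m → HasDegree f n → m ≡ n
  hasDegree-unique {m = m} {n} (lead-m , f≤m) (lead-n , f≤n) with <-cmp m n
  ... | tri< m<n _ _ = ⊥-elim (lead-n (f≤m n m<n))
  ... | tri≈ _ m≡n _ = m≡n
  ... | tri> _ _ n<m = ⊥-elim (lead-m (f≤n m n<m))

  hasDegree-+ₚ-dominantˡ : ∀ f g {k n} → HasDegree f n → DegreeAtMost g k → k < n → HasDegree (f +ₚ g) n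
  hasDegree-+ₚ-dominantˡ f g {n = n} (lead , f≤n) g≤k k<n =
    (λ sum[n]≈0 → lead (begin
      coeff f n                 ≈⟨ sym (+-identityʳ _) ⟩
      coeff f n ⊕ 0#            ≈⟨ +-congˡ (sym (g≤k n k<n)) ⟩
      coeff f n ⊕ coeff g n     ≈⟨ sym (coeff-+ₚ f g n) ⟩
      coeff (f +ₚ g) n          ≈⟨ sum[n]≈0 ⟩
      0#                        ∎)) ,
    λ i n<i → trans (coeff-+ₚ f g i) (trans (+-cong (f≤n i n<i) (g≤k i (<-trans k<n n<i))) (+-identityˡ 0#))

  hasDegree-+ₚ-dominantʳ : ∀ f g {k n} → DegreeAtMost f k → k < n → HasDegree g n → HasDegree (f +ₚ g) n
  hasDegree-+ₚ-dominantʳ f g {n = n} f≤k k<n (lead , g≤n) =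
    (λ sum[n]≈0 → lead (begin
      coeff g n                 ≈⟨ sym (+-identityˡ _) ⟩
      0# ⊕ coeff g n            ≈⟨ +-congʳ (sym (f≤k n k<n)) ⟩
      coeff f n ⊕ coeff g n     ≈⟨ sym (coeff-+ₚ f g n) ⟩
      coeff (f +ₚ g) n          ≈⟨ sum[n]≈0 ⟩
      0#                        ∎)) ,
    λ i n<i → trans (coeff-+ₚ f g i) (trans (+-cong (f≤k i (<-trans k<n n<i)) (g≤n i n<i)) (+-identityˡ 0#))

  module _ (_≟_ : Decidable _≈_) where
    open Degree _≟_

    LeadingIndex : Pol → Maybe ℕ → Set
    LeadingIndex f nothing = IsZero f
    LeadingIndex f (just n) = HasDegree f n

    leadingIndex-top : ∀ f → LeadingIndex f (top f)
    leadingIndex-top [] _ = refl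
    leadingIndex-top (a ∷ f) with top f | leadingIndex-top f
    ... | just n | lead , f≤n = lead , λ { (suc i) (s≤s n<i) → f≤n i n<i }
    ... | nothing | zero-f with a ≟ 0#
    ...   | yes a≈0 = λ { zero → a≈0 ; (suc i) → zero-f i }
    ...   | no a≉0 = a≉0 , λ { (suc i) _ → zero-f i }

    isZero⊎hasDegree-deg : ∀ f → IsZero f ⊎ HasDegree f (deg f)
    isZero⊎hasDegree-deg f with top f | leadingIndex-top f
    ... | just n | f-deg = inj₂ f-deg
    ... | nothing | zero-f = inj₁ zero-f

    hasDegree-deg : ∀ f → NonzeroPol f → HasDegree f (deg f)
    hasDegree-deg f f≢0 with isZero⊎hasDegree-deg f
    ... | inj₁ zero-f = ⊥-elim (f≢0 zero-f)
    ... | inj₂ f-deg = f-deg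

  module NoZeroDivisors (1≉0 : ¬ 1# ≈ 0#) (*-nonzero : ∀ {x y} → ¬ x ≈ 0# → ¬ y ≈ 0# → ¬ x ⊗ y ≈ 0#) where

    hasDegree-*ₚ : ∀ f g {m n} → HasDegree f m → HasDegree g n → HasDegree (f *ₚ g) (m + n)
    hasDegree-*ₚ [] g (lead , _) _ = ⊥-elim (lead refl)
    hasDegree-*ₚ (a ∷ f) g {zero} {n} (a≉0 , af≤0) (lead , g≤n) =
      (λ prod[n]≈0 → *-nonzero a≉0 lead (trans (sym (prod≈scaled n)) prod[n]≈0)) ,
      λ i n<i → trans (prod≈scaled i) (trans (*-congˡ (g≤n i n<i)) (zeroʳ a))
      where
      prod≈scaled : ∀ i → coeff ((a ∷ f) *ₚ g) i ≈ a ⊗ coeff g i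
      prod≈scaled i = trans (coeff-∷-*ₚ a f g i)
        (trans (+-congˡ (isZero-∷0# (isZero-*ₚ f g (λ j → af≤0 (suc j) (s≤s z≤n))) i)) (+-identityʳ _))
    hasDegree-*ₚ (a ∷ f) g {suc m} {n} (lead , af≤m+1) g-deg@(_ , g≤n) =
      (λ prod[m+n+1]≈0 → lead-fg (begin
        coeff (f *ₚ g) (m + n)                                ≈⟨ sym (+-identityˡ _) ⟩
        0# ⊕ coeff (f *ₚ g) (m + n)                           ≈⟨ +-congʳ (sym (a⊗g≈0 (s≤s (m≤n+m n m)))) ⟩
        a ⊗ coeff g (suc (m + n)) ⊕ coeff (f *ₚ g) (m + n)    ≈⟨ sym (coeff-∷-*ₚ a f g (suc (m + n))) ⟩
        coeff ((a ∷ f) *ₚ g) (suc (m + n))                    ≈⟨ prod[m+n+1]≈0 ⟩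
        0#                                                    ∎)) ,
      λ { (suc i) (s≤s m+n<i) → trans (coeff-∷-*ₚ a f g (suc i))
            (trans (+-cong (a⊗g≈0 (s≤s (≤-trans (m≤n+m n m) (<⇒≤ m+n<i)))) (fg≤m+n i m+n<i)) (+-identityˡ 0#)) }
      where
      fg-deg : HasDegree (f *ₚ g) (m + n)
      fg-deg = hasDegree-*ₚ f g (lead , λ i m<i → af≤m+1 (suc i) (s≤s m<i)) g-deg
      open HasDegree fg-deg renaming (leading≉0 to lead-fg; degreeAtMost to fg≤m+n)
      a⊗g≈0 : ∀ {i} → n < i → a ⊗ coeff g i ≈ 0#
      a⊗g≈0 n<i = trans (*-congˡ (g≤n _ n<i)) (zeroʳ a)

    hasDegree-oneₚ : HasDegree oneₚ 0
    hasDegree-oneₚ = 1≉0 , λ { (suc j) _ → refl }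

    hasDegree-T : HasDegree T 1
    hasDegree-T = 1≉0 , λ { (suc zero) (s≤s ()) ; (suc (suc j)) _ → refl }

    hasDegree-^ₚ : ∀ f {m} → HasDegree f m → ∀ k → HasDegree (f ^ₚ k) (k * m)
    hasDegree-^ₚ f f-deg zero = hasDegree-oneₚ
    hasDegree-^ₚ f f-deg (suc k) = hasDegree-*ₚ f (f ^ₚ k) f-deg (hasDegree-^ₚ f f-deg k)

    hasDegree-T^ : ∀ k → HasDegree (T ^ₚ k) k
    hasDegree-T^ zero = hasDegree-oneₚ
    hasDegree-T^ (suc k) = hasDegree-*ₚ T (T ^ₚ k) hasDegree-T (hasDegree-T^ k)

module CurveOverField (R : CommutativeRing 0ℓ 0ℓ) (_≟_ : Decidable (CommutativeRing._≈_ R)) (R-field : IsField R) where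
  open CommutativeRing R using (sym)
  open Poly R
  open Degree _≟_
  open PolynomialDegree R
  open NoZeroDivisors (proj₁ R-field) (IsField⇒*-nonzero R R-field)

  degreeAtMost-^ₚ-deg : ∀ f k → DegreeAtMost (f ^ₚ suc k) (suc k * deg f)
  degreeAtMost-^ₚ-deg f k with isZero⊎hasDegree-deg _≟_ f
  ... | inj₁ zero-f = isZero⇒degreeAtMost (f ^ₚ suc k) (isZero-*ₚ f (f ^ₚ k) zero-f) _
  ... | inj₂ f-deg = HasDegree.degreeAtMost (hasDegree-^ₚ f f-deg (suc k))

  degree-square-ratio : ∀ u v {w s m n} → NonzeroPol v → HasDegree w m → HasDegree s n
    → (u ^ₚ 2) *ₚ w ≈ₚ (v ^ₚ 2) *ₚ s → 2 * deg u + m ≡ 2 * deg v + n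
  degree-square-ratio u v {w} {s} {m} {n} v≢0 w-deg s-deg u²w≈v²s = compare (isZero⊎hasDegree-deg _≟_ u)
    where
    lhs-deg : HasDegree ((u ^ₚ 2) *ₚ w) (2 * deg v + n)
    lhs-deg = hasDegree-resp {f = (v ^ₚ 2) *ₚ s} (λ i → sym (u²w≈v²s i))
      (hasDegree-*ₚ (v ^ₚ 2) s (hasDegree-^ₚ v (hasDegree-deg _≟_ v v≢0) 2) s-deg)
    compare : IsZero u ⊎ HasDegree u (deg u) → 2 * deg u + m ≡ 2 * deg v + n
    compare (inj₁ zero-u) = ⊥-elim (HasDegree.leading≉0 lhs-deg (isZero-*ₚ (u ^ₚ 2) w (isZero-*ₚ u (u ^ₚ 1) zero-u) _))
    compare (inj₂ u-deg) = hasDegree-unique (hasDegree-*ₚ (u ^ₚ 2) w (hasDegree-^ₚ u u-deg 2) w-deg) lhs-deg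

  hasDegree-T^-T : ∀ {q} → 1 < q → HasDegree ((T ^ₚ q) -ₚ T) q
  hasDegree-T^-T {q} 1<q =
    hasDegree-+ₚ-dominantˡ (T ^ₚ q) (negₚ T) (hasDegree-T^ q) (degreeAtMost-negₚ T (HasDegree.degreeAtMost hasDegree-T)) 1<q

  hasDegree-curveRHS : ∀ {q} f g → 1 < q → NonzeroPol g → 3 * deg f < q + 3 * deg g
    → HasDegree ((f ^ₚ 3) +ₚ ((T ^ₚ q) -ₚ T) *ₚ (g ^ₚ 3)) (q + 3 * deg g)
  hasDegree-curveRHS {q} f g 1<q g≢0 3degf<q+3degg =
    hasDegree-+ₚ-dominantʳ (f ^ₚ 3) (((T ^ₚ q) -ₚ T) *ₚ (g ^ₚ 3)) (degreeAtMost-^ₚ-deg f 2) 3degf<q+3degg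
      (hasDegree-*ₚ ((T ^ₚ q) -ₚ T) (g ^ₚ 3) (hasDegree-T^-T 1<q) (hasDegree-^ₚ g (hasDegree-deg _≟_ g g≢0) 3))

  onCurve⇒2∣q : ∀ {q} f g u v → 1 < q → NonzeroPol g → NonzeroPol v → 3 * deg f < q + 3 * deg g
    → OnCurve q f g u v → 2 ∣ q
  onCurve⇒2∣q f g u v 1<q g≢0 v≢0 3degf<q+3degg onCurve =
    *+≡*+[+]⇒∣ {a = deg u} {b = deg v} (degree-square-ratio u v v≢0
      (hasDegree-^ₚ g (hasDegree-deg _≟_ g g≢0) 3) (hasDegree-curveRHS f g 1<q g≢0 3degf<q+3degg) onCurve)

proposition4p3 : (p c s : ℕ) → Prime p → 3 < p → p % 6 ≡ 5 → c % 2 ≡ 1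
    → SufficientlyLarge p c s
    → (R : CommutativeRing 0ℓ 0ℓ) → (_≟_ : Decidable (CommutativeRing._≈_ R))
    → IsField R → HasCardinality R (p ^ s)
    → (f g u v : Poly.Pol R)
    → Poly.NonzeroPol R g → Poly.NonzeroPol R v
    → Poly.Degree.Coprime R _≟_ f g
    → Poly.OnCurve R (p ^ c) f g u v
    → p ^ c + 1 ≤ 3 * Poly.Degree.height R _≟_ f g
proposition4p3 p zero s _ _ _ () _ R _≟_ _ _ f g u v _ _ _ _
proposition4p3 p c@(suc _) s p-prime 3<p _ _ _ R _≟_ R-field _ f g u v g≢0 v≢0 _ onCurve
  with p ^ c + 1 ≤? 3 * Poly.Degree.height R _≟_ f g
... | yes bound = bound
... | no ¬bound =
  ⊥-elim (prime∤prime^ c prime[2] p-prime 2<p (onCurve⇒2∣q f g u v 1<q g≢0 v≢0 3degf<q+3degg onCurve))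
  where
  open Poly.Degree R _≟_
  open CurveOverField R _≟_ R-field
  2<p : 2 < p
  2<p = <-trans (s≤s (s≤s (s≤s z≤n))) 3<p
  1<q : 1 < p ^ c
  1<q = ^-monoʳ-< p (<-trans (s≤s (s≤s z≤n)) 2<p) {0} {c} (s≤s z≤n)
  3height≤q : 3 * height f g ≤ p ^ c
  3height≤q = m<1+n⇒m≤n (≡.subst (3 * height f g <_) (+-comm (p ^ c) 1) (≰⇒> ¬bound))
  3degf<q+3degg : 3 * deg f < p ^ c + 3 * deg g
  3degf<q+3degg = ∤⇒*≤+*⇒*<+* {a = deg f} {b = deg g} (prime∤prime^ c prime[3] p-prime 3<p)
    (≤-trans (*-monoʳ-≤ 3 (m≤m⊔n (deg f) (deg g))) (≤-trans 3height≤q (m≤m+n (p ^ c) (3 * deg g))))
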